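{- Let $(\Gamma,\psi)$ be a divisible $H$-type asymptotic couple with asymptotic integration. Then $s0\neq0$, so either $s0<0$ or $0<s0$. Moreover, for every $q\in\mathbb{Q}^{>0}$: if $s0<0$ then $\Psi<(1-q)s0$, and if $0<s0$ then $\Psi<(1+q)s0$.
   Context: An asymptotic couple is $(\Gamma,\psi)$ with $\Gamma$ an ordered abelian group and $\psi:\Gamma\setminus\{0\}\to\Gamma$ satisfying (AC1) $\alpha+\beta\ne0\Rightarrow\psi(\alpha+\beta)\ge\min(\psi\alpha,\psi\beta)$, (AC2) $\psi(r\alpha)=\psi\alpha$ for $r\in\mathbb{Z}\setminus\{0\}$, (AC3) $\alpha>0\Rightarrow\alpha+\psi\alpha>\psi\beta$ (for $\alpha,\beta\ne0$). $H$-type: $0<\alpha\le\beta\Rightarrow\psi\alpha\ge\psi\beta$. $\gamma'=\gamma+\psi(\gamma)$; asymptotic integration: every $\alpha\in\Gamma$ equals $\beta'$ for a unique $\beta\ne0$, denoted $\int\alpha$; $s(\alpha):=\psi(\int\alpha)$. $\Psi:=\psi(\Gamma\setminus\{0\})$; $\Psi<x$ means every element of $\Psi$ is less than $x$. -}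

module Defs where

open import Level using (Level; suc; _⊔_)
open import Data.Nat as ℕ using (ℕ; zero)
open import Data.Integer as ℤ using (ℤ; +_; -[1+_])
open import Data.Rational as ℚ using (ℚ; ↥_; ↧ₙ_)
open import Data.Product using (Σ; ∃; _×_; _,_; proj₁)
open import Data.Sum using (_⊎_)
open import Relation.Binary.PropositionalEquality using (_≡_; _≢_)
open import Relation.Binary.Structures using (IsStrictTotalOrder)
open import Algebra.Structures using (IsAbelianGroup)

record OrderedAbelianGroup (c ℓ : Level) : Set (suc (c ⊔ ℓ)) where
  infixl 6 _+_
  infix 4 _<_ _≤_
  field
    Carrier   : Set c
    _+_       : Carrier → Carrier → Carrier
    0#        : Carrier
    -_        : Carrier → Carrier
    _<_       : Carrier → Carrier → Set ℓ
    isAbelianGroup    : IsAbelianGroup _≡_ _+_ 0# -_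
    isStrictTotalOrder : IsStrictTotalOrder _≡_ _<_
    +-mono-< : ∀ {a b} c → a < b → a + c < b + c

  _≤_ : Carrier → Carrier → Set (c ⊔ ℓ)
  a ≤ b = (a < b) ⊎ (a ≡ b)

  _·ℕ_ : ℕ → Carrier → Carrier
  zero ·ℕ a = 0#
  ℕ.suc n ·ℕ a = a + (n ·ℕ a)

  _·ℤ_ : ℤ → Carrier → Carrier
  (+ n) ·ℤ a = n ·ℕ a
  -[1+ n ] ·ℤ a = - (ℕ.suc n ·ℕ a)

  -- t is the rational multiple q·a, i.e. (denominator q)·t = (numerator q)·a
  IsQMul : ℚ → Carrier → Carrier → Set c
  IsQMul q a t = ((+ (↧ₙ q)) ·ℤ t) ≡ ((↥ q) ·ℤ a)

  Divisible : Set c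
  Divisible = ∀ (n : ℕ) (a : Carrier) → ∃ λ b → (ℕ.suc n ·ℕ b) ≡ a

-- An asymptotic couple.  ψ is given as a total function on Γ; its value at
-- 0 is irrelevant (all axioms and Ψ only concern nonzero arguments).
record AsymptoticCouple (c ℓ : Level) : Set (suc (c ⊔ ℓ)) where
  field
    Γ : OrderedAbelianGroup c ℓ
  open OrderedAbelianGroup Γ public
  field
    ψ   : Carrier → Carrier
    AC1 : ∀ α β → α ≢ 0# → β ≢ 0# → α + β ≢ 0# →
          (ψ α ≤ ψ (α + β)) ⊎ (ψ β ≤ ψ (α + β))
    AC2 : ∀ (r : ℤ) α → r ≢ + 0 → α ≢ 0# → ψ (r ·ℤ α) ≡ ψ α
    AC3 : ∀ α β → α ≢ 0# → β ≢ 0# → 0# < α → ψ β < α + ψ α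

  _′ : Carrier → Carrier
  γ ′ = γ + ψ γ

  HType : Set (c ⊔ ℓ)
  HType = ∀ α β → 0# < α → α ≤ β → ψ β ≤ ψ α

  HasAsymptoticIntegration : Set c
  HasAsymptoticIntegration =
    ∀ α → Σ Carrier λ β → (β ≢ 0# × β ′ ≡ α) ×
          (∀ γ → γ ≢ 0# → γ ′ ≡ α → γ ≡ β)

  ∫ : HasAsymptoticIntegration → Carrier → Carrier
  ∫ ai α = proj₁ (ai α)

  s : HasAsymptoticIntegration → Carrier → Carrier
  s ai α = ψ (∫ ai α)

  Ψ<_ : Carrier → Set (c ⊔ ℓ)
  Ψ< x = ∀ α → α ≢ 0# → ψ α < x

-- Let b = ∫ 0, so that b + ψ b = 0 and s0 = ψ b = − b ≠ 0.  If d·t = n·s0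
-- with (n − d)·s0 > 0, put x = t + b.  Then d·x = (n − d)·s0 > 0, so x > 0,
-- and by (AC2) ψ x = ψ ((n − d)·s0) = ψ s0 = ψ (− b) = s0; hence
-- x′ = t + b + s0 = t, and (AC3) gives Ψ < x′ = t.  For t = (1 ∓ q)·s0 we
-- have n/d = 1 ∓ q, so (n − d)·s0 = ∓ q d·s0 is positive exactly when s0 is
-- negative, resp. positive.
module Submission where

open import Defs
open import Data.Product using (_×_; _,_; proj₁; proj₂)
open import Data.Sum using (_⊎_; inj₁; inj₂)
open import Data.Rational as ℚ using (ℚ; Positive; 1ℚ; ↥_; ↧_) renaming (_+_ to _+ℚ_; _-_ to _-ℚ_)

open import Data.Empty using (⊥-elim)
open import Data.Nat as ℕ using (zero; suc)
import Data.Nat.Properties as ℕ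
open import Data.Integer as ℤ using (ℤ; -[1+_]; 0ℤ)
import Data.Integer.Properties as ℤ
import Data.Rational.Properties as ℚ
open import Relation.Binary.PropositionalEquality
  using (_≡_; _≢_; refl; sym; trans; cong; cong₂; subst; subst₂; module ≡-Reasoning)
open import Relation.Binary.Definitions using (tri<; tri≈; tri>)
open import Algebra.Bundles using (AbelianGroup)
open import Algebra.Structures using (IsAbelianGroup)
open import Relation.Binary.Structures using (IsStrictTotalOrder)
import Algebra.Properties.Group as GroupProperties
import Algebra.Properties.CommutativeSemigroup as CommutativeSemigroupProperties

module OrderedAbelianGroupProperties {c ℓ} (G : OrderedAbelianGroup c ℓ) where
  open OrderedAbelianGroup G
  open IsAbelianGroup isAbelianGroup
    using (assoc; comm; identityˡ; identityʳ; inverseʳ)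
  open IsStrictTotalOrder isStrictTotalOrder using (compare; irrefl; asym) renaming (trans to <-trans)
  open ≡-Reasoning

  abelianGroup : AbelianGroup c c
  abelianGroup = record { isAbelianGroup = isAbelianGroup }

  open AbelianGroup abelianGroup using (group; commutativeSemigroup)
  open GroupProperties group using (inverseʳ-unique; ε⁻¹≈ε; ⁻¹-anti-homo-∙)
  open CommutativeSemigroupProperties commutativeSemigroup using (interchange)

  -‿distrib-+ : ∀ a b → - (a + b) ≡ - a + - b
  -‿distrib-+ a b = trans (⁻¹-anti-homo-∙ a b) (comm (- b) (- a))

  ·ℕ-homo-+ : ∀ m n a → ((m ℕ.+ n) ·ℕ a) ≡ (m ·ℕ a) + (n ·ℕ a)
  ·ℕ-homo-+ zero    n a = sym (identityˡ _)
  ·ℕ-homo-+ (suc m) n a = trans (cong (a +_) (·ℕ-homo-+ m n a)) (sym (assoc a _ _))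

  ·ℕ-distrib-+ : ∀ n a b → (n ·ℕ (a + b)) ≡ (n ·ℕ a) + (n ·ℕ b)
  ·ℕ-distrib-+ zero    a b = sym (identityˡ 0#)
  ·ℕ-distrib-+ (suc n) a b =
    trans (cong ((a + b) +_) (·ℕ-distrib-+ n a b)) (interchange a b _ _)

  ·ℕ-zeroʳ : ∀ n → (n ·ℕ 0#) ≡ 0#
  ·ℕ-zeroʳ zero    = refl
  ·ℕ-zeroʳ (suc n) = trans (cong (0# +_) (·ℕ-zeroʳ n)) (identityˡ 0#)

  ·ℕ-distrib-neg : ∀ n a → (n ·ℕ (- a)) ≡ - (n ·ℕ a)
  ·ℕ-distrib-neg n a = inverseʳ-unique (n ·ℕ a) (n ·ℕ (- a)) (begin
    (n ·ℕ a) + (n ·ℕ (- a)) ≡⟨ ·ℕ-distrib-+ n a (- a) ⟨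
    n ·ℕ (a + - a)          ≡⟨ cong (n ·ℕ_) (inverseʳ a) ⟩
    n ·ℕ 0#                 ≡⟨ ·ℕ-zeroʳ n ⟩
    0#                      ∎)

  ·ℕ-minus-·ℕ : ∀ m n a → (m ·ℕ a) + - (n ·ℕ a) ≡ (m ℤ.⊖ n) ·ℤ a
  ·ℕ-minus-·ℕ m zero a = begin
    (m ·ℕ a) + - 0# ≡⟨ cong ((m ·ℕ a) +_) ε⁻¹≈ε ⟩
    (m ·ℕ a) + 0#   ≡⟨ identityʳ _ ⟩
    m ·ℕ a          ≡⟨ cong (_·ℤ a) (ℤ.⊖-≥ (ℕ.z≤n {m})) ⟨
    (m ℤ.⊖ zero) ·ℤ a ∎
  ·ℕ-minus-·ℕ zero (suc n) a = identityˡ _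
  ·ℕ-minus-·ℕ (suc m) (suc n) a = begin
    (a + (m ·ℕ a)) + - (a + (n ·ℕ a))   ≡⟨ cong ((a + (m ·ℕ a)) +_) (-‿distrib-+ a _) ⟩
    (a + (m ·ℕ a)) + (- a + - (n ·ℕ a)) ≡⟨ interchange a _ (- a) _ ⟩
    (a + - a) + ((m ·ℕ a) + - (n ·ℕ a)) ≡⟨ cong (_+ ((m ·ℕ a) + - (n ·ℕ a))) (inverseʳ a) ⟩
    0# + ((m ·ℕ a) + - (n ·ℕ a))        ≡⟨ identityˡ _ ⟩
    (m ·ℕ a) + - (n ·ℕ a)               ≡⟨ ·ℕ-minus-·ℕ m n a ⟩
    (m ℤ.⊖ n) ·ℤ a                      ≡⟨ cong (_·ℤ a) (ℤ.[1+m]⊖[1+n]≡m⊖n m n) ⟨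
    (suc m ℤ.⊖ suc n) ·ℤ a              ∎

  ·ℤ-homo-+ : ∀ i j a → (i ·ℤ a) + (j ·ℤ a) ≡ (i ℤ.+ j) ·ℤ a
  ·ℤ-homo-+ (ℤ.+ m)    (ℤ.+ n)    a = sym (·ℕ-homo-+ m n a)
  ·ℤ-homo-+ (ℤ.+ m)    -[1+ n ] a = ·ℕ-minus-·ℕ m (suc n) a
  ·ℤ-homo-+ -[1+ m ] (ℤ.+ n)    a = trans (comm _ _) (·ℕ-minus-·ℕ n (suc m) a)
  ·ℤ-homo-+ -[1+ m ] -[1+ n ] a = begin
    - (suc m ·ℕ a) + - (suc n ·ℕ a)     ≡⟨ -‿distrib-+ _ _ ⟨
    - ((suc m ·ℕ a) + (suc n ·ℕ a))     ≡⟨ cong -_ (·ℕ-homo-+ (suc m) (suc n) a) ⟨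
    - ((suc m ℕ.+ suc n) ·ℕ a)          ≡⟨ cong (λ k → - (suc k ·ℕ a)) (ℕ.+-suc m n) ⟩
    - (suc (suc (m ℕ.+ n)) ·ℕ a)        ∎

  0<⇒≢0 : ∀ {a} → 0# < a → a ≢ 0#
  0<⇒≢0 0<a a≡0 = irrefl refl (subst (0# <_) a≡0 0<a)

  <0⇒0<- : ∀ {a} → a < 0# → 0# < - a
  <0⇒0<- {a} a<0 =
    subst₂ _<_ (inverseʳ a) (identityˡ (- a)) (+-mono-< (- a) a<0)

  +-pos : ∀ {a b} → 0# < a → 0# < b → 0# < a + b
  +-pos {a} {b} 0<a 0<b =
    <-trans 0<b (subst (_< a + b) (identityˡ b) (+-mono-< b 0<a))

  +-neg : ∀ {a b} → a < 0# → b < 0# → a + b < 0#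
  +-neg {a} {b} a<0 b<0 =
    <-trans (subst (a + b <_) (identityˡ b) (+-mono-< b a<0)) b<0

  ·ℕ-pos : ∀ k {a} → 0# < a → 0# < (suc k ·ℕ a)
  ·ℕ-pos zero    {a} 0<a = subst (0# <_) (sym (identityʳ a)) 0<a
  ·ℕ-pos (suc k)     0<a = +-pos 0<a (·ℕ-pos k 0<a)

  ·ℕ-neg : ∀ k {a} → a < 0# → (suc k ·ℕ a) < 0#
  ·ℕ-neg zero    {a} a<0 = subst (_< 0#) (sym (identityʳ a)) a<0
  ·ℕ-neg (suc k)     a<0 = +-neg a<0 (·ℕ-neg k a<0)

  ·ℕ-pos⇒pos : ∀ k a → 0# < (suc k ·ℕ a) → 0# < a
  ·ℕ-pos⇒pos k a 0<ka with compare 0# a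
  ... | tri< 0<a _ _ = 0<a
  ... | tri≈ _ 0≡a _ =
    ⊥-elim (0<⇒≢0 0<ka (trans (cong (suc k ·ℕ_) (sym 0≡a)) (·ℕ-zeroʳ (suc k))))
  ... | tri> _ _ a<0 = ⊥-elim (asym 0<ka (·ℕ-neg k a<0))

  ·ℤ-pos-pos : ∀ i {a} → 0ℤ ℤ.< i → 0# < a → 0# < (i ·ℤ a)
  ·ℤ-pos-pos (ℤ.+ suc k) _ 0<a = ·ℕ-pos k 0<a
  ·ℤ-pos-pos (ℤ.+ zero) (ℤ.+<+ ()) _

  ·ℤ-neg-neg : ∀ i {a} → i ℤ.< 0ℤ → a < 0# → 0# < (i ·ℤ a)
  ·ℤ-neg-neg -[1+ k ] _ a<0 = <0⇒0<- (·ℕ-neg k a<0)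
  ·ℤ-neg-neg (ℤ.+ n) (ℤ.+<+ ()) _

module AsymptoticCoupleProperties {c ℓ} (C : AsymptoticCouple c ℓ) where
  open AsymptoticCouple C
  open OrderedAbelianGroupProperties Γ
  open IsAbelianGroup isAbelianGroup using (assoc; comm; identityʳ)
  open AbelianGroup abelianGroup using (group)
  open GroupProperties group using (inverseʳ-unique)
  open ≡-Reasoning

  Ψ<′ : ∀ {x} → 0# < x → Ψ< (x ′)
  Ψ<′ {x} 0<x α α≢0 = AC3 x α (0<⇒≢0 0<x) α≢0 0<x

  ψ-·ℕ≡·ℤ : ∀ k x i a → (suc k ·ℕ x) ≡ (i ·ℤ a) → x ≢ 0# → i ≢ ℤ.+ 0 → a ≢ 0# →
            ψ x ≡ ψ a
  ψ-·ℕ≡·ℤ k x i a kx≡ia x≢0 i≢0 a≢0 = begin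
    ψ x              ≡⟨ AC2 (ℤ.+ suc k) x (λ ()) x≢0 ⟨
    ψ (suc k ·ℕ x)   ≡⟨ cong ψ kx≡ia ⟩
    ψ (i ·ℤ a)       ≡⟨ AC2 i a i≢0 a≢0 ⟩
    ψ a              ∎

  module IntegralOfZero (b : Carrier) (b≢0 : b ≢ 0#) (b′≡0 : b ′ ≡ 0#) where

    b≡-ψb : b ≡ - ψ b
    b≡-ψb = inverseʳ-unique (ψ b) b (trans (comm (ψ b) b) b′≡0)

    ψb≢0 : ψ b ≢ 0#
    ψb≢0 ψb≡0 = b≢0 (trans (sym (identityʳ b)) (trans (cong (b +_) (sym ψb≡0)) b′≡0))

    ψ-ψb : ψ (ψ b) ≡ ψ b
    ψ-ψb = begin
      ψ (ψ b)             ≡⟨ cong ψ (inverseʳ-unique b (ψ b) b′≡0) ⟩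
      ψ (- b)             ≡⟨ cong (λ y → ψ (- y)) (identityʳ b) ⟨
      ψ (-[1+ 0 ] ·ℤ b)   ≡⟨ AC2 -[1+ 0 ] b (λ ()) b≢0 ⟩
      ψ b                 ∎

    Ψ<-multiple : ∀ k n t → (suc k ·ℕ t) ≡ (n ·ℤ ψ b) →
                  0# < ((n ℤ.- ℤ.+ suc k) ·ℤ ψ b) → Ψ< t
    Ψ<-multiple k n t kt≡nψb 0<mψb = subst Ψ<_ x′≡t (Ψ<′ 0<x)
      where
      x : Carrier
      x = t + b

      m : ℤ
      m = n ℤ.- ℤ.+ suc k

      kx≡mψb : (suc k ·ℕ x) ≡ (m ·ℤ ψ b)
      kx≡mψb = begin
        suc k ·ℕ (t + b)                   ≡⟨ ·ℕ-distrib-+ (suc k) t b ⟩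
        (suc k ·ℕ t) + (suc k ·ℕ b)        ≡⟨ cong₂ _+_ kt≡nψb (cong (suc k ·ℕ_) b≡-ψb) ⟩
        (n ·ℤ ψ b) + (suc k ·ℕ (- ψ b))    ≡⟨ cong ((n ·ℤ ψ b) +_) (·ℕ-distrib-neg (suc k) (ψ b)) ⟩
        (n ·ℤ ψ b) + (-[1+ k ] ·ℤ ψ b)     ≡⟨ ·ℤ-homo-+ n -[1+ k ] (ψ b) ⟩
        m ·ℤ ψ b                           ∎

      0<x : 0# < x
      0<x = ·ℕ-pos⇒pos k x (subst (0# <_) (sym kx≡mψb) 0<mψb)

      m≢0 : m ≢ ℤ.+ 0
      m≢0 m≡0 = 0<⇒≢0 0<mψb (cong (_·ℤ ψ b) m≡0)

      ψx≡ψb : ψ x ≡ ψ b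
      ψx≡ψb = trans (ψ-·ℕ≡·ℤ k x m (ψ b) kx≡mψb (0<⇒≢0 0<x) m≢0 ψb≢0) ψ-ψb

      x′≡t : x ′ ≡ t
      x′≡t = begin
        (t + b) + ψ x     ≡⟨ cong ((t + b) +_) ψx≡ψb ⟩
        (t + b) + ψ b     ≡⟨ assoc t b (ψ b) ⟩
        t + (b + ψ b)     ≡⟨ cong (t +_) b′≡0 ⟩
        t + 0#            ≡⟨ identityʳ t ⟩
        t                 ∎

i<j⇒i-j<0 : ∀ {i j} → i ℤ.< j → i ℤ.- j ℤ.< 0ℤ
i<j⇒i-j<0 {i} {j} i<j = subst (i ℤ.- j ℤ.<_) (ℤ.+-inverseʳ j) (ℤ.+-monoˡ-< (ℤ.- j) i<j)

i<j⇒0<j-i : ∀ {i j} → i ℤ.< j → 0ℤ ℤ.< j ℤ.- i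
i<j⇒0<j-i {i} {j} i<j = subst (ℤ._< j ℤ.- i) (ℤ.+-inverseʳ i) (ℤ.+-monoˡ-< (ℤ.- i) i<j)

<1⇒↥<↧ : ∀ {p} → p ℚ.< 1ℚ → ↥ p ℤ.< ↧ p
<1⇒↥<↧ p<1 = subst₂ ℤ._<_ (ℤ.*-identityʳ _) (ℤ.*-identityˡ _) (ℚ.drop-*<* p<1)

1<⇒↧<↥ : ∀ {p} → 1ℚ ℚ.< p → ↧ p ℤ.< ↥ p
1<⇒↧<↥ 1<p = subst₂ ℤ._<_ (ℤ.*-identityˡ _) (ℤ.*-identityʳ _) (ℚ.drop-*<* 1<p)

1-pos<1 : ∀ q → Positive q → 1ℚ -ℚ q ℚ.< 1ℚ
1-pos<1 q q>0 = subst (1ℚ -ℚ q ℚ.<_) (ℚ.+-identityʳ 1ℚ)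
  (ℚ.+-monoʳ-< 1ℚ (ℚ.neg-antimono-< (ℚ.positive⁻¹ q {{q>0}})))

1<1+pos : ∀ q → Positive q → 1ℚ ℚ.< 1ℚ +ℚ q
1<1+pos q q>0 = subst (ℚ._< 1ℚ +ℚ q) (ℚ.+-identityʳ 1ℚ)
  (ℚ.+-monoʳ-< 1ℚ (ℚ.positive⁻¹ q {{q>0}}))

lemma7p4 : ∀ {c ℓ} (C : AsymptoticCouple c ℓ) →
    let open AsymptoticCouple C in
    Divisible → HType → (ai : HasAsymptoticIntegration) →
    (s ai 0# ≢ 0#) × ((s ai 0# < 0#) ⊎ (0# < s ai 0#)) ×
    (∀ (q : ℚ) → Positive q →
    (s ai 0# < 0# → ∀ t → IsQMul (1ℚ -ℚ q) (s ai 0#) t → Ψ< t) ×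
    (0# < s ai 0# → ∀ t → IsQMul (1ℚ +ℚ q) (s ai 0#) t → Ψ< t))
lemma7p4 C _ _ ai = ψb≢0 , sign , λ q q>0 → below-neg q q>0 , below-pos q q>0
  where
  open AsymptoticCouple C
  open OrderedAbelianGroupProperties Γ using (·ℤ-neg-neg; ·ℤ-pos-pos)
  open AsymptoticCoupleProperties C
  open IsStrictTotalOrder isStrictTotalOrder using (compare)
  b : Carrier
  b = proj₁ (ai 0#)

  open IntegralOfZero b (proj₁ (proj₁ (proj₂ (ai 0#)))) (proj₂ (proj₁ (proj₂ (ai 0#))))

  sign : (ψ b < 0#) ⊎ (0# < ψ b)
  sign with compare (ψ b) 0#
  ... | tri< ψb<0 _ _ = inj₁ ψb<0
  ... | tri≈ _ ψb≡0 _ = ⊥-elim (ψb≢0 ψb≡0)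
  ... | tri> _ _ 0<ψb = inj₂ 0<ψb

  below-neg : ∀ q → Positive q → ψ b < 0# → ∀ t → IsQMul (1ℚ -ℚ q) (ψ b) t → Ψ< t
  below-neg q q>0 ψb<0 t dt≡nψb = Ψ<-multiple _ (↥ p) t dt≡nψb
    (·ℤ-neg-neg _ (i<j⇒i-j<0 (<1⇒↥<↧ (1-pos<1 q q>0))) ψb<0)
    where
    p : ℚ
    p = 1ℚ -ℚ q

  below-pos : ∀ q → Positive q → 0# < ψ b → ∀ t → IsQMul (1ℚ +ℚ q) (ψ b) t → Ψ< t
  below-pos q q>0 0<ψb t dt≡nψb = Ψ<-multiple _ (↥ p) t dt≡nψb
    (·ℤ-pos-pos _ (i<j⇒0<j-i (1<⇒↧<↥ (1<1+pos q q>0))) 0<ψb)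
    where
    p : ℚ
    p = 1ℚ +ℚ q
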